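{- Let $n\ge 1$ and $1\le m\le n-1$. The map $\varphi_m$ is a bijection from the set of anti-chains of size $m$ in $[n]\times[m]$ to the set of integer partitions $\lambda=(\lambda_1,\dots,\lambda_{n-m})\in\mathbb{N}^{n-m}$ (non-increasing sequences of nonnegative integers) with $\lambda_1\le m$.
   Context: $[k]=\{1,\dots,k\}$, $\mathbb{N}=\{0,1,2,\dots\}$. Order $[n]\times[n]$ by $(i,j)\le(k,l)$ iff $i\le k$ and $j\le l$; an anti-chain is a set of pairwise incomparable elements; for an anti-chain $Y$, $\mathrm{Down}(Y)=\{x: x<y \text{ for some } y\in Y\}$. For an anti-chain $\alpha$ of size $m$ in $[n]\times[m]$, let $\mathcal{D}(\alpha)=\{(i,j)\in\mathrm{Down}(\alpha): \text{there is no } k \text{ with } (i,k)\in\alpha\}$ and $\mathcal{D}_1(\alpha)=\{i\in[n]: \text{there is no } k \text{ with } (i,k)\in\alpha\}$, a set of size $n-m$. Let $d_i$ be the $i$-th smallest element of $\mathcal{D}_1(\alpha)$, and $\lambda_i=|\{j: (d_i,j)\in\mathcal{D}(\alpha)\}|$ for $1\le i\le n-m$. Then $\varphi_m(\alpha)=(\lambda_1,\dots,\lambda_{n-m})$. -}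

module Defs where

open import Data.Bool using (Bool; true; false; _∧_; _∨_; not; if_then_else_)
open import Data.Nat using (ℕ; zero; suc; _≤_; _∸_)
open import Data.Fin using (Fin; toℕ)
import Data.Fin as F
open import Data.Fin.Properties using (_≟_)
open import Data.List using (List; []; _∷_; length; map; filterᵇ; allFin)
open import Data.Nat.ListAction using (sum)
open import Data.Bool.ListAction using (any)
open import Data.Vec using (Vec; lookup)
import Data.Vec as V
open import Data.Product using (_×_; ∃; ∃-syntax; _,_)
open import Relation.Nullary using (¬_)
open import Relation.Nullary.Decidable using (⌊_⌋)
open import Relation.Binary.PropositionalEquality using (_≡_)
open import Data.Unit using (⊤)

-- A subset of [n] × [m] is an n-by-m Boolean table (row i = first coordinate).
-- Indices are 0-based Fin's; the order is the same as on [n] × [m].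
Subset₂ : ℕ → ℕ → Set
Subset₂ n m = Vec (Vec Bool m) n

memᵇ : ∀ {n m} → Subset₂ n m → Fin n → Fin m → Bool
memᵇ S i j = lookup (lookup S i) j

_∈₂_ : ∀ {n m} → Fin n × Fin m → Subset₂ n m → Set
(i , j) ∈₂ S = memᵇ S i j ≡ true

_≤₂_ : ∀ {n m} → Fin n × Fin m → Fin n × Fin m → Set
(i , j) ≤₂ (k , l) = (i F.≤ k) × (j F.≤ l)

IsAntichain : ∀ {n m} → Subset₂ n m → Set
IsAntichain {n} {m} S = ∀ (x y : Fin n × Fin m) → x ∈₂ S → y ∈₂ S → x ≤₂ y → x ≡ y

countTrue : ∀ {k} → Vec Bool k → ℕ
countTrue V.[] = 0
countTrue (true V.∷ v) = suc (countTrue v)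
countTrue (false V.∷ v) = countTrue v

card : ∀ {n m} → Subset₂ n m → ℕ
card {n} S = sum (map (λ i → countTrue (lookup S i)) (allFin n))

_<₂ᵇ_ : ∀ {n m} → Fin n × Fin m → Fin n × Fin m → Bool
(i , j) <₂ᵇ (k , l) = ⌊ i F.≤? k ⌋ ∧ ⌊ j F.≤? l ⌋ ∧ not (⌊ i ≟ k ⌋ ∧ ⌊ j ≟ l ⌋)

inDownᵇ : ∀ {n m} → Subset₂ n m → Fin n → Fin m → Bool
inDownᵇ {n} {m} S i j =
  any (λ k → any (λ l → memᵇ S k l ∧ ((i , j) <₂ᵇ (k , l))) (allFin m)) (allFin n)

rowEmptyᵇ : ∀ {n m} → Subset₂ n m → Fin n → Bool
rowEmptyᵇ {n} {m} S i = not (any (λ k → memᵇ S i k) (allFin m))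

in𝒟ᵇ : ∀ {n m} → Subset₂ n m → Fin n → Fin m → Bool
in𝒟ᵇ S i j = inDownᵇ S i j ∧ rowEmptyᵇ S i

𝒟₁ : ∀ {n m} → Subset₂ n m → List (Fin n)
𝒟₁ {n} S = filterᵇ (rowEmptyᵇ S) (allFin n)

lam : ∀ {n m} → Subset₂ n m → Fin n → ℕ
lam {n} {m} S d = length (filterᵇ (in𝒟ᵇ S d) (allFin m))

φ : ∀ {n m} → Subset₂ n m → List ℕ
φ S = map (lam S) (𝒟₁ S)

data NonIncreasing : List ℕ → Set where
  []  : NonIncreasing []
  [_] : ∀ x → NonIncreasing (x ∷ [])
  _∷_ : ∀ {x y ys} → y ≤ x → NonIncreasing (y ∷ ys) → NonIncreasing (x ∷ y ∷ ys)

HeadLe : ℕ → List ℕ → Set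
HeadLe m [] = ⊤
HeadLe m (x ∷ _) = x ≤ m

IsPartition : ℕ → ℕ → List ℕ → Set
IsPartition k m λs = (length λs ≡ k) × NonIncreasing λs × HeadLe m λs

IsAntichainOfSize : ∀ n m → Subset₂ n m → Set
IsAntichainOfSize n m S = IsAntichain S × card S ≡ m

module Submission where

-- Two points of an antichain never share a row or a column, and going down the rows its points move
-- strictly left. With m points in m columns every column is used, so an antichain of size m is the
-- same as a word of length n in ○ (empty row) and ● (occupied row) with m letters ●, the i-th ●
-- from the bottom carrying its point in column i. For an empty row d, the cells (d, j) lying below
-- a point are those weakly left of the first point under row d, so φ records for every ○ the number
-- of ● after it. This is the classical bijection between such words, i.e. lattice paths in an
-- (n − m) × m box, and partitions with n − m parts bounded by m.

open import Defs
open import Data.Nat using (ℕ; _≤_; _∸_)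
open import Data.List using (List)
open import Data.Product using (_×_; ∃-syntax)
open import Relation.Binary.PropositionalEquality using (_≡_)

open import Data.Bool using (Bool; true; false; _∧_; _∨_; not; if_then_else_)
import Data.Bool.Properties as Boolₚ
open import Data.Bool.ListAction using (any)
open import Data.Fin as F using (Fin; zero; suc; toℕ; fromℕ; inject₁)
import Data.Fin.Properties as Finₚ
open import Data.Fin.Relation.Unary.Top using (view; ‵fromℕ; ‵inject₁; view-fromℕ; view-inject₁)
open import Data.List using ([]; _∷_; length; map; filterᵇ; tabulate)
open import Data.List.Properties using (∷-injectiveʳ)
open import Data.List.Relation.Unary.All as All using (All; []; _∷_)
open import Data.Nat as ℕ using (zero; suc; _+_; _<_; z≤n; s≤s)
import Data.Nat.Properties as ℕₚ
open import Data.Nat.ListAction using (sum)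
open import Data.Product using (_,_; proj₁; proj₂)
open import Data.Product.Properties using (,-injective)
open import Data.Sum using (_⊎_; inj₁; inj₂)
open import Data.Unit using (tt)
open import Data.Vec as V using (Vec; lookup)
import Data.Vec.Properties as Vecₚ
open import Function using (_∘_; id)
open import Relation.Nullary using (¬_; yes; no; contradiction)
open import Relation.Binary.PropositionalEquality using (_≢_; _≗_; refl; sym; trans; cong; cong₂; subst; module ≡-Reasoning)

bit : Bool → ℕ
bit true  = 1
bit false = 0

count : ∀ {k} → (Fin k → Bool) → ℕ
count {zero}  f = 0
count {suc k} f = bit (f zero) + count (f ∘ suc)

anyᶠ : ∀ {k} → (Fin k → Bool) → Bool
anyᶠ {zero}  f = false
anyᶠ {suc k} f = f zero ∨ anyᶠ (f ∘ suc)

sumᶠ : ∀ {k} → (Fin k → ℕ) → ℕ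
sumᶠ {zero}  f = 0
sumᶠ {suc k} f = f zero + sumᶠ (f ∘ suc)

select : ∀ {k} → (Fin k → Bool) → (Fin k → ℕ) → List ℕ
select {zero}  p f = []
select {suc k} p f =
  if p zero then f zero ∷ select (p ∘ suc) (f ∘ suc) else select (p ∘ suc) (f ∘ suc)

count-cong : ∀ {k} {f g : Fin k → Bool} → f ≗ g → count f ≡ count g
count-cong {zero}  f≗g = refl
count-cong {suc k} f≗g = cong₂ _+_ (cong bit (f≗g zero)) (count-cong (f≗g ∘ suc))

anyᶠ-cong : ∀ {k} {f g : Fin k → Bool} → f ≗ g → anyᶠ f ≡ anyᶠ g
anyᶠ-cong {zero}  f≗g = refl
anyᶠ-cong {suc k} f≗g = cong₂ _∨_ (f≗g zero) (anyᶠ-cong (f≗g ∘ suc))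

sumᶠ-cong : ∀ {k} {f g : Fin k → ℕ} → f ≗ g → sumᶠ f ≡ sumᶠ g
sumᶠ-cong {zero}  f≗g = refl
sumᶠ-cong {suc k} f≗g = cong₂ _+_ (f≗g zero) (sumᶠ-cong (f≗g ∘ suc))

select-cong : ∀ {k} {p q : Fin k → Bool} {f g : Fin k → ℕ} → p ≗ q → f ≗ g → select p f ≡ select q g
select-cong {zero}  p≗q f≗g = refl
select-cong {suc k} p≗q f≗g
  rewrite p≗q zero | f≗g zero | select-cong (p≗q ∘ suc) (f≗g ∘ suc) = refl

select-true : ∀ {k} (p : Fin (suc k) → Bool) (f : Fin (suc k) → ℕ) →
              p zero ≡ true → select p f ≡ f zero ∷ select (p ∘ suc) (f ∘ suc)
select-true p f p0 rewrite p0 = refl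

select-false : ∀ {k} (p : Fin (suc k) → Bool) (f : Fin (suc k) → ℕ) →
               p zero ≡ false → select p f ≡ select (p ∘ suc) (f ∘ suc)
select-false p f p0 rewrite p0 = refl

anyᶠ-true⁻ : ∀ {k} (f : Fin k → Bool) → anyᶠ f ≡ true → ∃[ i ] f i ≡ true
anyᶠ-true⁻ {suc k} f any-f with f zero in f0
... | true  = zero , f0
... | false = let (i , fi) = anyᶠ-true⁻ (f ∘ suc) any-f in suc i , fi

anyᶠ-true⁺ : ∀ {k} (f : Fin k → Bool) i → f i ≡ true → anyᶠ f ≡ true
anyᶠ-true⁺ f zero    fi rewrite fi = refl
anyᶠ-true⁺ f (suc i) fi rewrite anyᶠ-true⁺ (f ∘ suc) i fi = Boolₚ.∨-zeroʳ (f zero)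

anyᶠ-false⁺ : ∀ {k} (f : Fin k → Bool) → (∀ i → f i ≡ false) → anyᶠ f ≡ false
anyᶠ-false⁺ {zero}  f none = refl
anyᶠ-false⁺ {suc k} f none rewrite none zero = anyᶠ-false⁺ (f ∘ suc) (none ∘ suc)

anyᶠ-init-last : ∀ {k} (f : Fin (suc k) → Bool) → anyᶠ f ≡ anyᶠ (f ∘ inject₁) ∨ f (fromℕ k)
anyᶠ-init-last {zero}  f = Boolₚ.∨-comm (f zero) false
anyᶠ-init-last {suc k} f
  rewrite anyᶠ-init-last (f ∘ suc) = sym (Boolₚ.∨-assoc (f zero) _ _)

count-false : ∀ {k} (f : Fin k → Bool) → (∀ i → f i ≡ false) → count f ≡ 0
count-false {zero}  f none = refl
count-false {suc k} f none rewrite none zero = count-false (f ∘ suc) (none ∘ suc)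

count-true : ∀ {k} (f : Fin k → Bool) → (∀ i → f i ≡ true) → count f ≡ k
count-true {zero}  f all = refl
count-true {suc k} f all rewrite all zero = cong suc (count-true (f ∘ suc) (all ∘ suc))

count-unique : ∀ {k} (f : Fin k → Bool) i → f i ≡ true → (∀ j → f j ≡ true → j ≡ i) → count f ≡ 1
count-unique f zero fi only rewrite fi =
  cong suc (count-false (f ∘ suc) λ j → Boolₚ.¬-not λ fj → contradiction (only (suc j) fj) λ ())
count-unique f (suc i) fi only rewrite Boolₚ.¬-not {f zero} (λ f0 → contradiction (only zero f0) λ ()) =
  count-unique (f ∘ suc) i fi λ j fj → Finₚ.suc-injective (only (suc j) fj)

count-init-last : ∀ {k} (f : Fin (suc k) → Bool) → count f ≡ count (f ∘ inject₁) + bit (f (fromℕ k))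
count-init-last {zero}  f = ℕₚ.+-comm (bit (f zero)) 0
count-init-last {suc k} f
  rewrite count-init-last (f ∘ suc) = sym (ℕₚ.+-assoc (bit (f zero)) _ _)

bool-ext : ∀ {a b : Bool} → (a ≡ true → b ≡ true) → (b ≡ true → a ≡ true) → a ≡ b
bool-ext {true}          a⇒b b⇒a = sym (a⇒b refl)
bool-ext {false} {true}  a⇒b b⇒a = b⇒a refl
bool-ext {false} {false} a⇒b b⇒a = refl

any-tabulate : ∀ {A : Set} {k} (p : A → Bool) (f : Fin k → A) → any p (tabulate f) ≡ anyᶠ (p ∘ f)
any-tabulate {k = zero}  p f = refl
any-tabulate {k = suc k} p f = cong (p (f zero) ∨_) (any-tabulate p (f ∘ suc))

length-filterᵇ-tabulate : ∀ {A : Set} {k} (p : A → Bool) (f : Fin k → A) →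
                          length (filterᵇ p (tabulate f)) ≡ count (p ∘ f)
length-filterᵇ-tabulate {k = zero}  p f = refl
length-filterᵇ-tabulate {k = suc k} p f with p (f zero)
... | true  = cong suc (length-filterᵇ-tabulate p (f ∘ suc))
... | false = length-filterᵇ-tabulate p (f ∘ suc)

map-filterᵇ-tabulate : ∀ {A : Set} {k} (g : A → ℕ) (p : A → Bool) (f : Fin k → A) →
                       map g (filterᵇ p (tabulate f)) ≡ select (p ∘ f) (g ∘ f)
map-filterᵇ-tabulate {k = zero}  g p f = refl
map-filterᵇ-tabulate {k = suc k} g p f with p (f zero)
... | true  = cong (g (f zero) ∷_) (map-filterᵇ-tabulate g p (f ∘ suc))
... | false = map-filterᵇ-tabulate g p (f ∘ suc)

sum-map-tabulate : ∀ {A : Set} {k} (g : A → ℕ) (f : Fin k → A) → sum (map g (tabulate f)) ≡ sumᶠ (g ∘ f)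
sum-map-tabulate {k = zero}  g f = refl
sum-map-tabulate {k = suc k} g f = cong (g (f zero) +_) (sum-map-tabulate g (f ∘ suc))

countTrue≡count : ∀ {k} (v : Vec Bool k) → countTrue v ≡ count (lookup v)
countTrue≡count V.[]           = refl
countTrue≡count (true  V.∷ v) = cong suc (countTrue≡count v)
countTrue≡count (false V.∷ v) = countTrue≡count v

-- Functions rather than vectors, so that the first row or the last column can be dropped freely.
Table : ℕ → ℕ → Set
Table n m = Fin n → Fin m → Bool

infix 4 _≐_

_≐_ : ∀ {n m} → Table n m → Table n m → Set
M ≐ N = ∀ i → M i ≗ N i

≐-trans : ∀ {n m} {M N P : Table n m} → M ≐ N → N ≐ P → M ≐ P
≐-trans M≐N N≐P i j = trans (M≐N i j) (N≐P i j)

toSubset : ∀ {n m} → Table n m → Subset₂ n m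
toSubset M = V.tabulate (V.tabulate ∘ M)

memᵇ-toSubset : ∀ {n m} (M : Table n m) → memᵇ (toSubset M) ≐ M
memᵇ-toSubset M i j rewrite Vecₚ.lookup∘tabulate (V.tabulate ∘ M) i = Vecₚ.lookup∘tabulate (M i) j

toSubset-memᵇ : ∀ {n m} (S : Subset₂ n m) → toSubset (memᵇ S) ≡ S
toSubset-memᵇ S = trans (Vecₚ.tabulate-cong (Vecₚ.tabulate∘lookup ∘ lookup S)) (Vecₚ.tabulate∘lookup S)

toSubset-cong : ∀ {n m} {M N : Table n m} → M ≐ N → toSubset M ≡ toSubset N
toSubset-cong M≐N = Vecₚ.tabulate-cong (Vecₚ.tabulate-cong ∘ M≐N)

cardᵗ : ∀ {n m} → Table n m → ℕ
cardᵗ M = sumᶠ (count ∘ M)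

rowEmptyᵗ : ∀ {n m} → Table n m → Fin n → Bool
rowEmptyᵗ M i = not (anyᶠ (M i))

inDownᵗ : ∀ {n m} → Table n m → Fin n → Fin m → Bool
inDownᵗ M i j = anyᶠ λ k → anyᶠ λ l → M k l ∧ ((i , j) <₂ᵇ (k , l))

in𝒟ᵗ : ∀ {n m} → Table n m → Fin n → Fin m → Bool
in𝒟ᵗ M i j = inDownᵗ M i j ∧ rowEmptyᵗ M i

lamᵗ : ∀ {n m} → Table n m → Fin n → ℕ
lamᵗ M d = count (in𝒟ᵗ M d)

φᵗ : ∀ {n m} → Table n m → List ℕ
φᵗ M = select (rowEmptyᵗ M) (lamᵗ M)

IsAntichainᵗ : ∀ {n m} → Table n m → Set
IsAntichainᵗ M = ∀ i k j l → M i j ≡ true → M k l ≡ true → i F.≤ k → j F.≤ l → i ≡ k × j ≡ l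

card≡cardᵗ : ∀ {n m} (S : Subset₂ n m) → card S ≡ cardᵗ (memᵇ S)
card≡cardᵗ S = trans (sum-map-tabulate (countTrue ∘ lookup S) id) (sumᶠ-cong (countTrue≡count ∘ lookup S))

φ≡φᵗ : ∀ {n m} (S : Subset₂ n m) → φ S ≡ φᵗ (memᵇ S)
φ≡φᵗ S = trans (map-filterᵇ-tabulate (lam S) (rowEmptyᵇ S) id) (select-cong rowEmpty≡ lam≡)
  where
  rowEmpty≡ : ∀ i → rowEmptyᵇ S i ≡ rowEmptyᵗ (memᵇ S) i
  rowEmpty≡ i = cong not (any-tabulate (memᵇ S i) id)
  inDown≡ : ∀ i j → inDownᵇ S i j ≡ inDownᵗ (memᵇ S) i j
  inDown≡ i j = trans (any-tabulate (λ k → any (above k) (tabulate id)) id)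
                      (anyᶠ-cong λ k → any-tabulate (above k) id)
    where
    above : Fin _ → Fin _ → Bool
    above k l = memᵇ S k l ∧ ((i , j) <₂ᵇ (k , l))
  lam≡ : ∀ d → lam S d ≡ lamᵗ (memᵇ S) d
  lam≡ d = trans (length-filterᵇ-tabulate (in𝒟ᵇ S d) id)
                 (count-cong λ j → cong₂ _∧_ (inDown≡ d j) (rowEmpty≡ d))

cardᵗ-cong : ∀ {n m} {M N : Table n m} → M ≐ N → cardᵗ M ≡ cardᵗ N
cardᵗ-cong M≐N = sumᶠ-cong (count-cong ∘ M≐N)

φᵗ-cong : ∀ {n m} {M N : Table n m} → M ≐ N → φᵗ M ≡ φᵗ N
φᵗ-cong {M = M} {N} M≐N = select-cong rowEmpty≡ λ d → count-cong λ j → cong₂ _∧_ (inDown≡ d j) (rowEmpty≡ d)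
  where
  rowEmpty≡ : ∀ i → rowEmptyᵗ M i ≡ rowEmptyᵗ N i
  rowEmpty≡ i = cong not (anyᶠ-cong (M≐N i))
  inDown≡ : ∀ i j → inDownᵗ M i j ≡ inDownᵗ N i j
  inDown≡ i j = anyᶠ-cong λ k → anyᶠ-cong λ l → cong (_∧ _) (M≐N k l)

IsAntichainᵗ-resp : ∀ {n m} {M N : Table n m} → M ≐ N → IsAntichainᵗ M → IsAntichainᵗ N
IsAntichainᵗ-resp M≐N ac i k j l Nij Nkl = ac i k j l (trans (M≐N i j) Nij) (trans (M≐N k l) Nkl)

IsAntichain⇒IsAntichainᵗ : ∀ {n m} (S : Subset₂ n m) → IsAntichain S → IsAntichainᵗ (memᵇ S)
IsAntichain⇒IsAntichainᵗ S ac i k j l Sij Skl i≤k j≤l = ,-injective (ac (i , j) (k , l) Sij Skl (i≤k , j≤l))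

IsAntichainᵗ⇒IsAntichain : ∀ {n m} (S : Subset₂ n m) → IsAntichainᵗ (memᵇ S) → IsAntichain S
IsAntichainᵗ⇒IsAntichain S ac (i , j) (k , l) Sij Skl (i≤k , j≤l) =
  let (i≡k , j≡l) = ac i k j l Sij Skl i≤k j≤l in cong₂ _,_ i≡k j≡l

_<₂_ : ∀ {n m} → Fin n × Fin m → Fin n × Fin m → Set
x <₂ y = x ≤₂ y × x ≢ y

<₂ᵇ-true⁻ : ∀ {n m} (x y : Fin n × Fin m) → (x <₂ᵇ y) ≡ true → x <₂ y
<₂ᵇ-true⁻ (i , j) (k , l) x<y with i F.≤? k | j F.≤? l | i Finₚ.≟ k | j Finₚ.≟ l
... | yes i≤k | yes j≤l | no i≢k | _      = (i≤k , j≤l) , i≢k ∘ cong proj₁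
... | yes i≤k | yes j≤l | yes _  | no j≢l = (i≤k , j≤l) , j≢l ∘ cong proj₂
... | yes _   | yes _   | yes _  | yes _  = contradiction x<y λ ()
... | yes _   | no _    | _      | _      = contradiction x<y λ ()
... | no _    | _       | _      | _      = contradiction x<y λ ()

<₂ᵇ-true⁺ : ∀ {n m} (x y : Fin n × Fin m) → x <₂ y → (x <₂ᵇ y) ≡ true
<₂ᵇ-true⁺ (i , j) (k , l) ((i≤k , j≤l) , x≢y) with i F.≤? k | j F.≤? l | i Finₚ.≟ k | j Finₚ.≟ l
... | yes _ | yes _   | yes i≡k | yes j≡l = contradiction (cong₂ _,_ i≡k j≡l) x≢y
... | yes _ | yes _   | yes _   | no _    = refl
... | yes _ | yes _   | no _    | _       = refl
... | yes _ | no j≰l  | _       | _       = contradiction j≤l j≰l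
... | no i≰k | _      | _       | _       = contradiction i≤k i≰k

Down : ∀ {n m} → Table n m → Fin n → Fin m → Set
Down M i j = ∃[ k ] ∃[ l ] (M k l ≡ true × (i , j) <₂ (k , l))

inDownᵗ-true⁻ : ∀ {n m} (M : Table n m) i j → inDownᵗ M i j ≡ true → Down M i j
inDownᵗ-true⁻ M i j down =
  let (k , someₗ) = anyᶠ-true⁻ _ down
      (l , above) = anyᶠ-true⁻ _ someₗ
  in k , l , Boolₚ.∧-conicalˡ _ _ above , <₂ᵇ-true⁻ (i , j) (k , l) (Boolₚ.∧-conicalʳ (M k l) _ above)

inDownᵗ-true⁺ : ∀ {n m} (M : Table n m) i j → Down M i j → inDownᵗ M i j ≡ true
inDownᵗ-true⁺ M i j (k , l , Mkl , ij<kl) =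
  anyᶠ-true⁺ _ k (anyᶠ-true⁺ _ l (cong₂ _∧_ Mkl (<₂ᵇ-true⁺ (i , j) (k , l) ij<kl)))

inDownᵗ-≡ : ∀ {n m n′ m′} (M : Table n m) (N : Table n′ m′) i j i′ j′ →
            (Down M i j → Down N i′ j′) → (Down N i′ j′ → Down M i j) → inDownᵗ M i j ≡ inDownᵗ N i′ j′
inDownᵗ-≡ M N i j i′ j′ M⇒N N⇒M =
  bool-ext (inDownᵗ-true⁺ N i′ j′ ∘ M⇒N ∘ inDownᵗ-true⁻ M i j)
           (inDownᵗ-true⁺ M i j ∘ N⇒M ∘ inDownᵗ-true⁻ N i′ j′)

-- Growing a table by a first row and a last column

extend : ∀ {m} → (Fin m → Bool) → Bool → Fin (suc m) → Bool
extend g b j with view j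
... | ‵fromℕ     = b
... | ‵inject₁ l = g l

extend-fromℕ : ∀ {m} (g : Fin m → Bool) b → extend g b (fromℕ m) ≡ b
extend-fromℕ {m} g b rewrite view-fromℕ m = refl

extend-inject₁ : ∀ {m} (g : Fin m → Bool) b l → extend g b (inject₁ l) ≡ g l
extend-inject₁ g b l rewrite view-inject₁ l = refl

extend-cong : ∀ {m} {g h : Fin m → Bool} b → g ≗ h → extend g b ≗ extend h b
extend-cong b g≗h j with view j
... | ‵fromℕ     = refl
... | ‵inject₁ l = g≗h l

extend-false-true⁻ : ∀ {m} (g : Fin m → Bool) j → extend g false j ≡ true →
                     ∃[ l ] (j ≡ inject₁ l × g l ≡ true)
extend-false-true⁻ g j gj with view j
... | ‵inject₁ l = l , refl , gj

count-extend : ∀ {m} (g : Fin m → Bool) b → count (extend g b) ≡ count g + bit b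
count-extend g b =
  trans (count-init-last (extend g b)) (cong₂ _+_ (count-cong (extend-inject₁ g b)) (cong bit (extend-fromℕ g b)))

anyᶠ-extend-false : ∀ {m} (g : Fin m → Bool) → anyᶠ (extend g false) ≡ anyᶠ g
anyᶠ-extend-false g = begin
  anyᶠ (extend g false)
    ≡⟨ anyᶠ-init-last (extend g false) ⟩
  anyᶠ (extend g false ∘ inject₁) ∨ extend g false (fromℕ _)
    ≡⟨ cong₂ _∨_ (anyᶠ-cong (extend-inject₁ g false)) (extend-fromℕ g false) ⟩
  anyᶠ g ∨ false
    ≡⟨ Boolₚ.∨-identityʳ (anyᶠ g) ⟩
  anyᶠ g ∎
  where open ≡-Reasoning

topRow : ∀ {m} → Fin (suc m) → Bool
topRow = extend (λ _ → false) true

topRow-fromℕ : ∀ m → topRow (fromℕ m) ≡ true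
topRow-fromℕ m = extend-fromℕ {m} (λ _ → false) true

topRow-true⁻ : ∀ {m} (j : Fin (suc m)) → topRow j ≡ true → j ≡ fromℕ m
topRow-true⁻ j top with view j
... | ‵fromℕ = refl

count-topRow : ∀ {m} → count (topRow {m}) ≡ 1
count-topRow {m} = trans (count-extend {m} (λ _ → false) true) (cong (_+ 1) (count-false {m} (λ _ → false) λ _ → refl))

fromℕ≰inject₁ : ∀ {m} (l : Fin m) → ¬ (fromℕ m F.≤ inject₁ l)
fromℕ≰inject₁ l top≤l = Finₚ.fromℕ≢inject₁ (Finₚ.≤-antisym top≤l (Finₚ.≤fromℕ (inject₁ l)))

inject₁-≤⁻ : ∀ {m} (j l : Fin m) → inject₁ j F.≤ inject₁ l → j F.≤ l
inject₁-≤⁻ j l rewrite Finₚ.toℕ-inject₁ j | Finₚ.toℕ-inject₁ l = λ j≤l → j≤l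

inject₁-≤⁺ : ∀ {m} (j l : Fin m) → j F.≤ l → inject₁ j F.≤ inject₁ l
inject₁-≤⁺ j l rewrite Finₚ.toℕ-inject₁ j | Finₚ.toℕ-inject₁ l = λ j≤l → j≤l

padᵗ : ∀ {n m} → Table n m → Table n (suc m)
padᵗ N i = extend (N i) false

infixr 5 ○∷ᵗ_ ●∷ᵗ_

○∷ᵗ_ : ∀ {n m} → Table n m → Table (suc n) m
(○∷ᵗ N) zero    j = false
(○∷ᵗ N) (suc i) j = N i j

●∷ᵗ_ : ∀ {n m} → Table n m → Table (suc n) (suc m)
(●∷ᵗ N) zero    = topRow
(●∷ᵗ N) (suc i) = padᵗ N i

○∷ᵗ-cong : ∀ {n m} {M N : Table n m} → M ≐ N → ○∷ᵗ M ≐ ○∷ᵗ N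
○∷ᵗ-cong M≐N zero    j = refl
○∷ᵗ-cong M≐N (suc i) j = M≐N i j

●∷ᵗ-cong : ∀ {n m} {M N : Table n m} → M ≐ N → ●∷ᵗ M ≐ ●∷ᵗ N
●∷ᵗ-cong M≐N zero    j = refl
●∷ᵗ-cong M≐N (suc i) j = extend-cong false (M≐N i) j

cardᵗ-○∷ᵗ : ∀ {n m} (N : Table n m) → cardᵗ (○∷ᵗ N) ≡ cardᵗ N
cardᵗ-○∷ᵗ {m = m} N = cong (_+ cardᵗ N) (count-false {m} (λ _ → false) λ _ → refl)

cardᵗ-●∷ᵗ : ∀ {n m} (N : Table n m) → cardᵗ (●∷ᵗ N) ≡ suc (cardᵗ N)
cardᵗ-●∷ᵗ {m = m} N = cong₂ _+_ (count-topRow {m})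
  (trans (sumᶠ-cong λ i → count-extend (N i) false) (sumᶠ-cong λ i → ℕₚ.+-identityʳ (count (N i))))

○∷ᵗ-antichain⁺ : ∀ {n m} {N : Table n m} → IsAntichainᵗ N → IsAntichainᵗ (○∷ᵗ N)
○∷ᵗ-antichain⁺ ac zero    k       j l () _ _ _
○∷ᵗ-antichain⁺ ac (suc i) zero    j l _ () _ _
○∷ᵗ-antichain⁺ ac (suc i) (suc k) j l Nij Nkl (s≤s i≤k) j≤l =
  let (i≡k , j≡l) = ac i k j l Nij Nkl i≤k j≤l in cong suc i≡k , j≡l

●∷ᵗ-antichain⁺ : ∀ {n m} {N : Table n m} → IsAntichainᵗ N → IsAntichainᵗ (●∷ᵗ N)
●∷ᵗ-antichain⁺ ac zero zero j l top top′ _ _ = refl , trans (topRow-true⁻ j top) (sym (topRow-true⁻ l top′))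
●∷ᵗ-antichain⁺ {N = N} ac zero (suc k) j l top Nkl _ j≤l
  with topRow-true⁻ j top | extend-false-true⁻ (N k) l Nkl
... | refl | l′ , refl , _ = contradiction j≤l (fromℕ≰inject₁ l′)
●∷ᵗ-antichain⁺ ac (suc i) zero j l _ _ () _
●∷ᵗ-antichain⁺ {N = N} ac (suc i) (suc k) j l Nij Nkl (s≤s i≤k) j≤l
  with extend-false-true⁻ (N i) j Nij | extend-false-true⁻ (N k) l Nkl
... | j′ , refl , Nij′ | l′ , refl , Nkl′ =
  let (i≡k , j′≡l′) = ac i k j′ l′ Nij′ Nkl′ i≤k (inject₁-≤⁻ j′ l′ j≤l)
  in cong suc i≡k , cong inject₁ j′≡l′

●∷ᵗ-antichain⁻ : ∀ {n m} {N : Table n m} → IsAntichainᵗ (●∷ᵗ N) → IsAntichainᵗ N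
●∷ᵗ-antichain⁻ {N = N} ac i k j l Nij Nkl i≤k j≤l =
  let (i≡k , j≡l) = ac (suc i) (suc k) (inject₁ j) (inject₁ l)
                       (trans (extend-inject₁ (N i) false j) Nij) (trans (extend-inject₁ (N k) false l) Nkl)
                       (s≤s i≤k) (inject₁-≤⁺ j l j≤l)
  in Finₚ.suc-injective i≡k , Finₚ.inject₁-injective j≡l

inDownᵗ-suc : ∀ {n m} (M : Table (suc n) m) d j → inDownᵗ M (suc d) j ≡ inDownᵗ (M ∘ suc) d j
inDownᵗ-suc M d j = inDownᵗ-≡ M (M ∘ suc) (suc d) j d j drop lift
  where
  drop : Down M (suc d) j → Down (M ∘ suc) d j
  drop (suc k , l , Mkl , (s≤s d≤k , j≤l) , ≢kl) = k , l , Mkl , (d≤k , j≤l) , λ { refl → ≢kl refl }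
  lift : Down (M ∘ suc) d j → Down M (suc d) j
  lift (k , l , Mkl , (d≤k , j≤l) , ≢kl) = suc k , l , Mkl , (s≤s d≤k , j≤l) , λ { refl → ≢kl refl }

lamᵗ-suc : ∀ {n m} (M : Table (suc n) m) d → lamᵗ M (suc d) ≡ lamᵗ (M ∘ suc) d
lamᵗ-suc M d = count-cong λ j → cong (_∧ rowEmptyᵗ M (suc d)) (inDownᵗ-suc M d j)

φᵗ-tail : ∀ {n m} (M : Table (suc n) m) → rowEmptyᵗ M zero ≡ false → φᵗ M ≡ φᵗ (M ∘ suc)
φᵗ-tail M occupied = trans (select-false (rowEmptyᵗ M) (lamᵗ M) occupied) (select-cong (λ _ → refl) (lamᵗ-suc M))

φᵗ-○∷ᵗ : ∀ {n m} (N : Table n m) → (∀ (j : Fin m) → ∃[ k ] ∃[ l ] (N k l ≡ true × j F.≤ l)) →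
         φᵗ (○∷ᵗ N) ≡ m ∷ φᵗ N
φᵗ-○∷ᵗ N covered =
  trans (select-true (rowEmptyᵗ (○∷ᵗ N)) (lamᵗ (○∷ᵗ N)) rowEmpty₀)
        (cong₂ _∷_ lam₀ (select-cong (λ _ → refl) (lamᵗ-suc (○∷ᵗ N))))
  where
  rowEmpty₀ : rowEmptyᵗ (○∷ᵗ N) zero ≡ true
  rowEmpty₀ = cong not (anyᶠ-false⁺ ((○∷ᵗ N) zero) λ _ → refl)
  under : ∀ j → Down (○∷ᵗ N) zero j
  under j = let (k , l , Nkl , j≤l) = covered j in suc k , l , Nkl , (z≤n , j≤l) , λ ()
  lam₀ : lamᵗ (○∷ᵗ N) zero ≡ _
  lam₀ = count-true (in𝒟ᵗ (○∷ᵗ N) zero) λ j →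
           cong₂ _∧_ (inDownᵗ-true⁺ (○∷ᵗ N) zero j (under j)) rowEmpty₀

inDownᵗ-padᵗ-inject₁ : ∀ {n m} (N : Table n m) d j → inDownᵗ (padᵗ N) d (inject₁ j) ≡ inDownᵗ N d j
inDownᵗ-padᵗ-inject₁ N d j = inDownᵗ-≡ (padᵗ N) N d (inject₁ j) d j unpad pad
  where
  unpad : Down (padᵗ N) d (inject₁ j) → Down N d j
  unpad (k , l , Nkl , (d≤k , j≤l) , ≢kl) with extend-false-true⁻ (N k) l Nkl
  ... | l′ , refl , Nkl′ = k , l′ , Nkl′ , (d≤k , inject₁-≤⁻ j l′ j≤l) , λ { refl → ≢kl refl }
  pad : Down N d j → Down (padᵗ N) d (inject₁ j)
  pad (k , l , Nkl , (d≤k , j≤l) , ≢kl) =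
    k , inject₁ l , trans (extend-inject₁ (N k) false l) Nkl , (d≤k , inject₁-≤⁺ j l j≤l) ,
    λ eq → ≢kl (cong₂ _,_ (cong proj₁ eq) (Finₚ.inject₁-injective (cong proj₂ eq)))

inDownᵗ-padᵗ-fromℕ : ∀ {n m} (N : Table n m) d → inDownᵗ (padᵗ N) d (fromℕ m) ≡ false
inDownᵗ-padᵗ-fromℕ N d = Boolₚ.¬-not (nothingAbove ∘ inDownᵗ-true⁻ (padᵗ N) d _)
  where
  nothingAbove : ¬ Down (padᵗ N) d (fromℕ _)
  nothingAbove (k , l , Nkl , (_ , top≤l) , _) with extend-false-true⁻ (N k) l Nkl
  ... | l′ , refl , _ = fromℕ≰inject₁ l′ top≤l

φᵗ-padᵗ : ∀ {n m} (N : Table n m) → φᵗ (padᵗ N) ≡ φᵗ N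
φᵗ-padᵗ N = select-cong rowEmpty≡ lam≡
  where
  open ≡-Reasoning
  rowEmpty≡ : ∀ i → rowEmptyᵗ (padᵗ N) i ≡ rowEmptyᵗ N i
  rowEmpty≡ i = cong not (anyᶠ-extend-false (N i))
  lam≡ : ∀ d → lamᵗ (padᵗ N) d ≡ lamᵗ N d
  lam≡ d = begin
    lamᵗ (padᵗ N) d
      ≡⟨ count-init-last (in𝒟ᵗ (padᵗ N) d) ⟩
    count (in𝒟ᵗ (padᵗ N) d ∘ inject₁) + bit (in𝒟ᵗ (padᵗ N) d (fromℕ _))
      ≡⟨ cong₂ _+_ (count-cong λ j → cong₂ _∧_ (inDownᵗ-padᵗ-inject₁ N d j) (rowEmpty≡ d))
                   (cong (λ b → bit (b ∧ rowEmptyᵗ (padᵗ N) d)) (inDownᵗ-padᵗ-fromℕ N d)) ⟩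
    lamᵗ N d + 0
      ≡⟨ ℕₚ.+-identityʳ (lamᵗ N d) ⟩
    lamᵗ N d ∎

φᵗ-●∷ᵗ : ∀ {n m} (N : Table n m) → φᵗ (●∷ᵗ N) ≡ φᵗ N
φᵗ-●∷ᵗ {m = m} N = trans (φᵗ-tail (●∷ᵗ N) occupied₀) (φᵗ-padᵗ N)
  where
  occupied₀ : rowEmptyᵗ (●∷ᵗ N) zero ≡ false
  occupied₀ = cong not (anyᶠ-true⁺ topRow (fromℕ m) (topRow-fromℕ m))

-- Antichains of size m

allFalse⊎someTrue : ∀ {k} (f : Fin k → Bool) → (∀ i → f i ≡ false) ⊎ (∃[ i ] f i ≡ true)
allFalse⊎someTrue f with Finₚ.any? (λ i → f i Boolₚ.≟ true)
... | yes some = inj₂ some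
... | no  none = inj₁ λ i → Boolₚ.¬-not λ fi → none (i , fi)

antichain-tail : ∀ {n m} {M : Table (suc n) m} → IsAntichainᵗ M → IsAntichainᵗ (M ∘ suc)
antichain-tail ac i k j l Mij Mkl i≤k j≤l =
  let (i≡k , j≡l) = ac (suc i) (suc k) j l Mij Mkl (s≤s i≤k) j≤l in Finₚ.suc-injective i≡k , j≡l

antichain-row-unique : ∀ {n m} {M : Table n m} → IsAntichainᵗ M →
                       ∀ {i j j′} → M i j ≡ true → M i j′ ≡ true → j ≡ j′
antichain-row-unique ac {i} {j} {j′} Mij Mij′ with Finₚ.≤-total j j′
... | inj₁ j≤j′ = proj₂ (ac i i j j′ Mij Mij′ Finₚ.≤-refl j≤j′)
... | inj₂ j′≤j = sym (proj₂ (ac i i j′ j Mij′ Mij Finₚ.≤-refl j′≤j))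

antichain-row-count : ∀ {n m} {M : Table n m} → IsAntichainᵗ M → ∀ {i j} → M i j ≡ true → count (M i) ≡ 1
antichain-row-count {M = M} ac {i} {j} Mij = count-unique (M i) j Mij λ j′ Mij′ → antichain-row-unique ac Mij′ Mij

antichain-lower : ∀ {n m} {M : Table n m} → IsAntichainᵗ M →
                  ∀ {i j k l} → M i j ≡ true → M k l ≡ true → i F.< k → l F.< j
antichain-lower ac {i} {j} {k} {l} Mij Mkl i<k with j F.≤? l
... | yes j≤l = contradiction (proj₁ (ac i k j l Mij Mkl (ℕₚ.<⇒≤ i<k) j≤l)) (Finₚ.<⇒≢ i<k)
... | no  j≰l = ℕₚ.≰⇒> j≰l

cardᵗ-bound : ∀ {n m} (M : Table n m) → IsAntichainᵗ M →
              ∀ c → (∀ i j → M i j ≡ true → toℕ j < c) → cardᵗ M ≤ c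
cardᵗ-bound {zero}  _ _ _ _ = z≤n
cardᵗ-bound {suc n} M ac c below-c with allFalse⊎someTrue (M zero)
... | inj₁ empty rewrite count-false (M zero) empty =
  cardᵗ-bound (M ∘ suc) (antichain-tail ac) c (below-c ∘ suc)
... | inj₂ (j , M0j) rewrite antichain-row-count ac M0j =
  ℕₚ.≤-trans (s≤s (cardᵗ-bound (M ∘ suc) (antichain-tail ac) (toℕ j) λ i l Mil →
                     antichain-lower ac M0j Mil ℕ.z<s))
             (below-c zero j M0j)

data FirstRow {n} : ∀ {m} → Table (suc n) m → Set where
  unoccupied : ∀ {m} {M : Table (suc n) m} (N : Table n m) → M ≐ ○∷ᵗ N → FirstRow M
  occupied   : ∀ {m} {M : Table (suc n) (suc m)} (N : Table n m) → M ≐ ●∷ᵗ N → FirstRow M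

-- The other m − 1 points of M lie strictly left of the one in the first row, which therefore sits
-- in the last column.
occupiedFirstRow : ∀ {n m} (M : Table (suc n) m) → IsAntichainᵗ M → cardᵗ M ≡ m →
                   ∀ j → M zero j ≡ true → FirstRow M
occupiedFirstRow {m = suc m} M ac card≡m j M0j = occupied (λ i → M (suc i) ∘ inject₁) M≐
  where
  cardTail : cardᵗ (M ∘ suc) ≡ m
  cardTail = ℕₚ.suc-injective (trans (cong (_+ cardᵗ (M ∘ suc)) (sym (antichain-row-count ac M0j))) card≡m)
  m≤j : m ≤ toℕ j
  m≤j = subst (_≤ toℕ j) cardTail
          (cardᵗ-bound (M ∘ suc) (antichain-tail ac) (toℕ j) λ i l Mil → antichain-lower ac M0j Mil ℕ.z<s)
  j≡top : j ≡ fromℕ m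
  j≡top = Finₚ.≤-antisym (Finₚ.≤fromℕ j) (subst (_≤ toℕ j) (sym (Finₚ.toℕ-fromℕ m)) m≤j)
  M0top : M zero (fromℕ m) ≡ true
  M0top = subst (λ x → M zero x ≡ true) j≡top M0j
  M≐ : M ≐ ●∷ᵗ (λ i → M (suc i) ∘ inject₁)
  M≐ zero j′ with view j′
  ... | ‵fromℕ     = M0top
  ... | ‵inject₁ l = Boolₚ.¬-not λ M0l → Finₚ.fromℕ≢inject₁ (sym (antichain-row-unique ac M0l M0top))
  M≐ (suc i) j′ with view j′
  ... | ‵fromℕ     = Boolₚ.¬-not λ Mi-top → Finₚ.<-irrefl refl (antichain-lower ac M0top Mi-top ℕ.z<s)
  ... | ‵inject₁ l = refl

firstRow : ∀ {n m} (M : Table (suc n) m) → IsAntichainᵗ M → cardᵗ M ≡ m → FirstRow M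
firstRow M ac card≡m with allFalse⊎someTrue (M zero)
... | inj₁ empty      = unoccupied (M ∘ suc) λ { zero j → empty j ; (suc i) j → refl }
... | inj₂ (j , M0j) = occupiedFirstRow M ac card≡m j M0j

-- Words in ○ and ●

infixr 5 ○∷_ ●∷_

data Pattern : ℕ → ℕ → Set where
  []  : Pattern 0 0
  ○∷_ : ∀ {n m} → Pattern n m → Pattern (suc n) m
  ●∷_ : ∀ {n m} → Pattern n m → Pattern (suc n) (suc m)

encode : ∀ {n m} → Pattern n m → Table n m
encode []     = λ ()
encode (○∷ w) = ○∷ᵗ encode w
encode (●∷ w) = ●∷ᵗ encode w

encode-antichain : ∀ {n m} (w : Pattern n m) → IsAntichainᵗ (encode w)
encode-antichain []     = λ ()
encode-antichain (○∷ w) = ○∷ᵗ-antichain⁺ (encode-antichain w)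
encode-antichain (●∷ w) = ●∷ᵗ-antichain⁺ (encode-antichain w)

cardᵗ-encode : ∀ {n m} (w : Pattern n m) → cardᵗ (encode w) ≡ m
cardᵗ-encode []     = refl
cardᵗ-encode (○∷ w) = trans (cardᵗ-○∷ᵗ (encode w)) (cardᵗ-encode w)
cardᵗ-encode (●∷ w) = trans (cardᵗ-●∷ᵗ (encode w)) (cong suc (cardᵗ-encode w))

encode-lastColumn : ∀ {n m} (w : Pattern n (suc m)) → ∃[ k ] encode w k (fromℕ m) ≡ true
encode-lastColumn (○∷ w) = let (k , wk) = encode-lastColumn w in suc k , wk
encode-lastColumn {m = m} (●∷ w) = zero , topRow-fromℕ m

decompose : ∀ {n m} (M : Table n m) → IsAntichainᵗ M → cardᵗ M ≡ m → ∃[ w ] M ≐ encode w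
decompose {zero}  _ _ refl = [] , λ ()
decompose {suc n} M ac card≡m with firstRow M ac card≡m
... | unoccupied N M≐ =
  let (w , N≐) = decompose N (antichain-tail (IsAntichainᵗ-resp M≐ ac))
                   (trans (sym (cardᵗ-○∷ᵗ N)) (trans (sym (cardᵗ-cong M≐)) card≡m))
  in ○∷ w , ≐-trans M≐ (○∷ᵗ-cong N≐)
... | occupied N M≐ =
  let (w , N≐) = decompose N (●∷ᵗ-antichain⁻ (IsAntichainᵗ-resp M≐ ac))
                   (ℕₚ.suc-injective (trans (sym (cardᵗ-●∷ᵗ N)) (trans (sym (cardᵗ-cong M≐)) card≡m)))
  in ●∷ w , ≐-trans M≐ (●∷ᵗ-cong N≐)

shape : ∀ {n m} → Pattern n m → List ℕ
shape []               = []
shape (○∷_ {m = m} w) = m ∷ shape w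
shape (●∷ w)           = shape w

φᵗ-encode : ∀ {n m} (w : Pattern n m) → φᵗ (encode w) ≡ shape w
φᵗ-encode []     = refl
φᵗ-encode (○∷_ {m = m} w) = trans (φᵗ-○∷ᵗ (encode w) (covered w)) (cong (m ∷_) (φᵗ-encode w))
  where
  covered : ∀ {n m} (w : Pattern n m) (j : Fin m) → ∃[ k ] ∃[ l ] (encode w k l ≡ true × j F.≤ l)
  covered {m = zero}  w ()
  covered {m = suc m} w j = let (k , wk) = encode-lastColumn w in k , fromℕ m , wk , Finₚ.≤fromℕ j
φᵗ-encode (●∷ w) = trans (φᵗ-●∷ᵗ (encode w)) (φᵗ-encode w)

-- Shapes and partitions

shape-bounded : ∀ {n m} (w : Pattern n m) → All (_≤ m) (shape w)
shape-bounded []     = []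
shape-bounded (○∷ w) = ℕₚ.≤-refl ∷ shape-bounded w
shape-bounded (●∷ w) = All.map ℕₚ.m≤n⇒m≤1+n (shape-bounded w)

nonIncreasing-∷ : ∀ {x xs} → All (_≤ x) xs → NonIncreasing xs → NonIncreasing (x ∷ xs)
nonIncreasing-∷ {x} []        []  = [ x ]
nonIncreasing-∷     (y≤x ∷ _) ni = y≤x ∷ ni

nonIncreasing-tail : ∀ {x xs} → NonIncreasing (x ∷ xs) → NonIncreasing xs
nonIncreasing-tail [ x ]    = []
nonIncreasing-tail (_ ∷ ni) = ni

nonIncreasing-bounded : ∀ {m xs} → NonIncreasing xs → HeadLe m xs → All (_≤ m) xs
nonIncreasing-bounded []         _   = []
nonIncreasing-bounded [ x ]      x≤m = x≤m ∷ []
nonIncreasing-bounded (y≤x ∷ ni) x≤m = x≤m ∷ nonIncreasing-bounded ni (ℕₚ.≤-trans y≤x x≤m)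

All⇒HeadLe : ∀ {m xs} → All (_≤ m) xs → HeadLe m xs
All⇒HeadLe []        = tt
All⇒HeadLe (x≤m ∷ _) = x≤m

shape-nonIncreasing : ∀ {n m} (w : Pattern n m) → NonIncreasing (shape w)
shape-nonIncreasing []     = []
shape-nonIncreasing (○∷ w) = nonIncreasing-∷ (shape-bounded w) (shape-nonIncreasing w)
shape-nonIncreasing (●∷ w) = shape-nonIncreasing w

shape-length : ∀ {n m} (w : Pattern n m) → length (shape w) + m ≡ n
shape-length []                = refl
shape-length (○∷ w)            = cong suc (shape-length w)
shape-length {m = suc m} (●∷ w) = trans (ℕₚ.+-suc (length (shape w)) m) (cong suc (shape-length w))

shape-isPartition : ∀ {n m} (w : Pattern n m) → IsPartition (n ∸ m) m (shape w)
shape-isPartition {m = m} w =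
  subst (λ k → length (shape w) ≡ k ∸ m) (shape-length w) (sym (ℕₚ.m+n∸n≡m (length (shape w)) m)) ,
  shape-nonIncreasing w ,
  All⇒HeadLe (shape-bounded w)

shape-○∷≢●∷ : ∀ {n m} (w : Pattern n (suc m)) (w′ : Pattern n m) → shape (○∷ w) ≢ shape (●∷ w′)
shape-○∷≢●∷ {m = m} w w′ eq with subst (All (_≤ m)) (sym eq) (shape-bounded w′)
... | 1+m≤m ∷ _ = ℕₚ.1+n≰n 1+m≤m

shape-injective : ∀ {n m} (w w′ : Pattern n m) → shape w ≡ shape w′ → w ≡ w′
shape-injective []     []      _  = refl
shape-injective (○∷ w) (○∷ w′) eq = cong ○∷_ (shape-injective w w′ (∷-injectiveʳ eq))
shape-injective (○∷ w) (●∷ w′) eq = contradiction eq (shape-○∷≢●∷ w w′)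
shape-injective (●∷ w) (○∷ w′) eq = contradiction (sym eq) (shape-○∷≢●∷ w′ w)
shape-injective (●∷ w) (●∷ w′) eq = cong ●∷_ (shape-injective w w′ eq)

allOccupied : ∀ m → Pattern m m
allOccupied zero    = []
allOccupied (suc m) = ●∷ allOccupied m

shape-allOccupied : ∀ m → shape (allOccupied m) ≡ []
shape-allOccupied zero    = refl
shape-allOccupied (suc m) = shape-allOccupied m

shape-surjective : ∀ {n m} (λs : List ℕ) → length λs + m ≡ n → NonIncreasing λs → All (_≤ m) λs →
                   ∃[ w ] shape {n} {m} w ≡ λs
shape-surjective {m = m} []       refl _  _ = allOccupied m , shape-allOccupied m
shape-surjective {zero}  (x ∷ xs) ()   _  _
shape-surjective {suc n} (x ∷ xs) len ni (x≤m ∷ xs≤m) with ℕₚ.m≤n⇒m<n∨m≡n x≤m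
... | inj₂ refl =
  let (w , shape≡) = shape-surjective xs (ℕₚ.suc-injective len) (nonIncreasing-tail ni) xs≤m
  in ○∷ w , cong (x ∷_) shape≡
... | inj₁ (s≤s {n = m′} x≤m′) =
  let (w , shape≡) = shape-surjective (x ∷ xs) (trans (sym (ℕₚ.+-suc (length xs) m′)) (ℕₚ.suc-injective len))
                                      ni (nonIncreasing-bounded ni x≤m′)
  in ●∷ w , shape≡

partition⇒shape : ∀ {n m} {λs : List ℕ} → m ≤ n → IsPartition (n ∸ m) m λs →
                  ∃[ w ] shape {n} {m} w ≡ λs
partition⇒shape {m = m} {λs} m≤n (len , ni , head≤m) =
  shape-surjective λs (trans (cong (_+ m) len) (ℕₚ.m∸n+n≡m m≤n)) ni (nonIncreasing-bounded ni head≤m)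

antichainOf : ∀ {n m} → Pattern n m → Subset₂ n m
antichainOf = toSubset ∘ encode

antichainOf-isAntichainOfSize : ∀ {n m} (w : Pattern n m) → IsAntichainOfSize n m (antichainOf w)
antichainOf-isAntichainOfSize w =
  IsAntichainᵗ⇒IsAntichain (antichainOf w)
    (IsAntichainᵗ-resp (λ i j → sym (memᵇ-toSubset (encode w) i j)) (encode-antichain w)) ,
  trans (card≡cardᵗ (antichainOf w)) (trans (cardᵗ-cong (memᵇ-toSubset (encode w))) (cardᵗ-encode w))

φ-antichainOf : ∀ {n m} (w : Pattern n m) → φ (antichainOf w) ≡ shape w
φ-antichainOf w = trans (φ≡φᵗ (antichainOf w)) (trans (φᵗ-cong (memᵇ-toSubset (encode w))) (φᵗ-encode w))

antichain⇒antichainOf : ∀ {n m} (α : Subset₂ n m) → IsAntichainOfSize n m α → ∃[ w ] α ≡ antichainOf w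
antichain⇒antichainOf α (ac , card≡m) =
  let (w , α≐w) = decompose (memᵇ α) (IsAntichain⇒IsAntichainᵗ α ac) (trans (sym (card≡cardᵗ α)) card≡m)
  in w , trans (sym (toSubset-memᵇ α)) (toSubset-cong α≐w)

lemma3p6 : (n m : ℕ) → 1 ≤ n → 1 ≤ m → m ≤ n ∸ 1 →
    ((α : Subset₂ n m) → IsAntichainOfSize n m α → IsPartition (n ∸ m) m (φ α))
    × ((α β : Subset₂ n m) → IsAntichainOfSize n m α → IsAntichainOfSize n m β → φ α ≡ φ β → α ≡ β)
    × ((λs : List ℕ) → IsPartition (n ∸ m) m λs → ∃[ α ] (IsAntichainOfSize n m α × φ α ≡ λs))
lemma3p6 n m _ _ m≤n∸1 = partition , injective , surjective
  where
  partition : (α : Subset₂ n m) → IsAntichainOfSize n m α → IsPartition (n ∸ m) m (φ α)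
  partition α α-ac with antichain⇒antichainOf α α-ac
  ... | w , refl = subst (IsPartition (n ∸ m) m) (sym (φ-antichainOf w)) (shape-isPartition w)
  injective : (α β : Subset₂ n m) → IsAntichainOfSize n m α → IsAntichainOfSize n m β → φ α ≡ φ β → α ≡ β
  injective α β α-ac β-ac φα≡φβ with antichain⇒antichainOf α α-ac | antichain⇒antichainOf β β-ac
  ... | w , refl | w′ , refl =
    cong antichainOf (shape-injective w w′ (trans (sym (φ-antichainOf w)) (trans φα≡φβ (φ-antichainOf w′))))
  surjective : (λs : List ℕ) → IsPartition (n ∸ m) m λs → ∃[ α ] (IsAntichainOfSize n m α × φ α ≡ λs)
  surjective λs λs-partition with partition⇒shape (ℕₚ.≤-trans m≤n∸1 (ℕₚ.m∸n≤m n 1)) λs-partition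
  ... | w , refl = antichainOf w , antichainOf-isAntichainOfSize w , φ-antichainOf w
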